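{- For every formula $A$ of $L$ there exist implicative formulas $B_1, \dots, B_n$ (with $n \geq 1$) such that $$\vdash A \leftrightarrow (B_1 \& \dots \& B_n) \quad\text{and}\quad \models A \leftrightarrow (B_1 \& \dots \& B_n).$$
   Context: **Language.** Let $L$ be the propositional language whose formulas are built as follows: - the atomic formulas are $p_1, p_2, \dots$; - if $A$ and $B$ are formulas, so are $(A \to B)$, $(A \vee B)$ and $(A \& B)$. Iterated connectives associate to the right. For example, $B_1 \& \dots \& B_n$ means $B_1 \& (B_2 \& (\dots \& B_n))$, which is just $B_1$ when $n=1$. A formula containing only the connective $\to$ is called implicative. $C \leftrightarrow D$ abbreviates $(C \to D) \& (D \to C)$. **Calculus.** $\vdash$ denotes thesishood in the classical positive propositional calculus on $L$. Its axiom schemes are: - $A \to B \to A$; - $(A \to B \to C) \to (A \to B) \to A \to C$; - $((A \to B) \to A) \to A$; - $A \to (A \vee B)$; - $A \to (B \vee A)$; - $(A \to C) \to (B \to C) \to (A \vee B) \to C$; - $(A \& B) \to A$; - $(A \& B) \to B$; - $A \to B \to (A \& B)$. Its only rule is modus ponens. **Semantics.** $\models$ denotes being a classical tautology. -}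

module Defs where

open import Data.Nat using (ℕ)
open import Data.Bool using (Bool; true; false; _∧_; _∨_; not)
open import Data.List using (List; []; _∷_)
open import Data.List.NonEmpty using (List⁺; _∷_)
open import Data.List.Relation.Unary.All using (All)
open import Relation.Binary.PropositionalEquality using (_≡_)

-- Formulas of L. Atom p_i is represented as (var i); indexing starts at 0
-- instead of 1, which is an immaterial renaming.
infixr 5 _⇒_
infixr 6 _∨ᶠ_
infixr 7 _&_
data Formula : Set where
  var  : ℕ → Formula
  _⇒_  : Formula → Formula → Formula
  _∨ᶠ_ : Formula → Formula → Formula
  _&_  : Formula → Formula → Formula

data Implicative : Formula → Set where
  var : ∀ i → Implicative (var i)
  _⇒_ : ∀ {A B} → Implicative A → Implicative B → Implicative (A ⇒ B)

_⇔_ : Formula → Formula → Formula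
C ⇔ D = (C ⇒ D) & (D ⇒ C)

bigAnd : List⁺ Formula → Formula
bigAnd (B ∷ Bs) = go B Bs
  where
  go : Formula → List Formula → Formula
  go B []        = B
  go B (C ∷ Cs)  = B & go C Cs

data ⊢_ : Formula → Set where
  ax-K    : ∀ A B → ⊢ (A ⇒ B ⇒ A)
  ax-S    : ∀ A B C → ⊢ ((A ⇒ B ⇒ C) ⇒ (A ⇒ B) ⇒ A ⇒ C)
  ax-P    : ∀ A B → ⊢ (((A ⇒ B) ⇒ A) ⇒ A)
  ax-∨I₁  : ∀ A B → ⊢ (A ⇒ (A ∨ᶠ B))
  ax-∨I₂  : ∀ A B → ⊢ (A ⇒ (B ∨ᶠ A))
  ax-∨E   : ∀ A B C → ⊢ ((A ⇒ C) ⇒ (B ⇒ C) ⇒ (A ∨ᶠ B) ⇒ C)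
  ax-&E₁  : ∀ A B → ⊢ ((A & B) ⇒ A)
  ax-&E₂  : ∀ A B → ⊢ ((A & B) ⇒ B)
  ax-&I   : ∀ A B → ⊢ (A ⇒ B ⇒ (A & B))
  mp      : ∀ {A B} → ⊢ (A ⇒ B) → ⊢ A → ⊢ B

⟦_⟧ : Formula → (ℕ → Bool) → Bool
⟦ var i ⟧  v = v i
⟦ A ⇒ B ⟧  v = not (⟦ A ⟧ v) ∨ ⟦ B ⟧ v
⟦ A ∨ᶠ B ⟧ v = ⟦ A ⟧ v ∨ ⟦ B ⟧ v
⟦ A & B ⟧  v = ⟦ A ⟧ v ∧ ⟦ B ⟧ v

⊨_ : Formula → Set
⊨ A = (v : ℕ → Bool) → ⟦ A ⟧ v ≡ true

module Submission where

-- Positive classical logic proves the equivalences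
--   A ⇒ (B & C) ≈ (A ⇒ B) & (A ⇒ C),   (A & B) ⇒ C ≈ A ⇒ B ⇒ C,
--   (A & B) ∨ C ≈ (A ∨ C) & (B ∨ C),   A ∨ B ≈ (A ⇒ B) ⇒ B,
-- the last one by Peirce's law. Pushing & outwards with the first three and
-- eliminating ∨ with the last, an induction on A turns every formula into a
-- provably equivalent conjunction of implicative formulas; the equivalence is
-- then a tautology by soundness.

open import Defs
open import Data.Bool using (true; false; _∧_; _∨_; not)
open import Data.List as List using (List; []; _∷_)
open import Data.List.Membership.Propositional using (_∈_)
open import Data.List.NonEmpty as List⁺ using (List⁺; _∷_; [_]; toList; _⁺++⁺_; foldr₁)
open import Data.List.NonEmpty.Properties using (map-∘)
open import Data.List.Relation.Unary.All as All using (All; []; _∷_)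
open import Data.List.Relation.Unary.All.Properties using (++⁺; map⁺)
open import Data.List.Relation.Unary.Any using (here; there)
open import Data.Product using (Σ; _×_; _,_; swap)
open import Function using (_∘_)
open import Level using (0ℓ)
open import Relation.Binary.Bundles using (Setoid)
import Relation.Binary.Reasoning.Setoid
open import Relation.Binary.PropositionalEquality using (_≡_; refl; cong)

infix 2 _⊩_
infixl 5 _·_

data _⊩_ (Γ : List Formula) : Formula → Set where
  hyp : ∀ {A} → A ∈ Γ → Γ ⊩ A
  thm : ∀ {A} → ⊢ A → Γ ⊩ A
  _·_ : ∀ {A B} → Γ ⊩ (A ⇒ B) → Γ ⊩ A → Γ ⊩ B

-- The deduction theorem, by bracket abstraction with the combinators K and S.
ƛ : ∀ {Γ A B} → (A ∷ Γ) ⊩ B → Γ ⊩ (A ⇒ B)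
ƛ {A = A} (hyp (here refl)) = thm (ax-S A (A ⇒ A) A) · thm (ax-K A (A ⇒ A)) · thm (ax-K A A)
ƛ (hyp (there A∈Γ))         = thm (ax-K _ _) · hyp A∈Γ
ƛ (thm ⊢A)                  = thm (ax-K _ _) · thm ⊢A
ƛ (f · x)                   = thm (ax-S _ _ _) · ƛ f · ƛ x

closed : ∀ {A} → [] ⊩ A → ⊢ A
closed (hyp ())
closed (thm ⊢A) = ⊢A
closed (f · x)  = mp (closed f) (closed x)

#0 : ∀ {Γ A} → (A ∷ Γ) ⊩ A
#0 = hyp (here refl)

#1 : ∀ {Γ A B} → (B ∷ A ∷ Γ) ⊩ A
#1 = hyp (there (here refl))

#2 : ∀ {Γ A B C} → (C ∷ B ∷ A ∷ Γ) ⊩ A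
#2 = hyp (there (there (here refl)))

module _ {Γ : List Formula} {A B : Formula} where

  &-intro : Γ ⊩ (A ⇒ B ⇒ (A & B))
  &-intro = thm (ax-&I A B)

  &-fst : Γ ⊩ ((A & B) ⇒ A)
  &-fst = thm (ax-&E₁ A B)

  &-snd : Γ ⊩ ((A & B) ⇒ B)
  &-snd = thm (ax-&E₂ A B)

  ∨-inl : Γ ⊩ (A ⇒ (A ∨ᶠ B))
  ∨-inl = thm (ax-∨I₁ A B)

  ∨-inr : Γ ⊩ (B ⇒ (A ∨ᶠ B))
  ∨-inr = thm (ax-∨I₂ B A)

  ∨-elim : ∀ {C} → Γ ⊩ ((A ⇒ C) ⇒ (B ⇒ C) ⇒ (A ∨ᶠ B) ⇒ C)
  ∨-elim = thm (ax-∨E A B _)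

  peirce : Γ ⊩ (((A ⇒ B) ⇒ A) ⇒ A)
  peirce = thm (ax-P A B)

infix 3 _≈_

_≈_ : Formula → Formula → Set
A ≈ B = ⊢ (A ⇒ B) × ⊢ (B ⇒ A)

≈-refl : ∀ {A} → A ≈ A
≈-refl = closed (ƛ #0) , closed (ƛ #0)

≈-trans : ∀ {A B C} → A ≈ B → B ≈ C → A ≈ C
≈-trans (f , g) (h , k) = closed (ƛ (thm h · (thm f · #0))) , closed (ƛ (thm g · (thm k · #0)))

≈-setoid : Setoid 0ℓ 0ℓ
≈-setoid = record
  { Carrier       = Formula
  ; _≈_           = _≈_
  ; isEquivalence = record { refl = ≈-refl ; sym = swap ; trans = ≈-trans }
  }

≈⇒⊢⇔ : ∀ {A B} → A ≈ B → ⊢ (A ⇔ B)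
≈⇒⊢⇔ (f , g) = mp (mp (ax-&I _ _) f) g

⇒-cong : ∀ {A A′ B B′} → A ≈ A′ → B ≈ B′ → (A ⇒ B) ≈ (A′ ⇒ B′)
⇒-cong (f , g) (h , k) =
  closed (ƛ (ƛ (thm h · (#1 · (thm g · #0))))) ,
  closed (ƛ (ƛ (thm k · (#1 · (thm f · #0)))))

&-cong : ∀ {A A′ B B′} → A ≈ A′ → B ≈ B′ → (A & B) ≈ (A′ & B′)
&-cong (f , g) (h , k) =
  closed (ƛ (&-intro · (thm f · (&-fst · #0)) · (thm h · (&-snd · #0)))) ,
  closed (ƛ (&-intro · (thm g · (&-fst · #0)) · (thm k · (&-snd · #0))))

∨-cong : ∀ {A A′ B B′} → A ≈ A′ → B ≈ B′ → (A ∨ᶠ B) ≈ (A′ ∨ᶠ B′)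
∨-cong (f , g) (h , k) =
  closed (∨-elim · ƛ (∨-inl · (thm f · #0)) · ƛ (∨-inr · (thm h · #0))) ,
  closed (∨-elim · ƛ (∨-inl · (thm g · #0)) · ƛ (∨-inr · (thm k · #0)))

&-assoc : ∀ {A B C} → ((A & B) & C) ≈ (A & (B & C))
&-assoc =
  closed (ƛ (&-intro · (&-fst · (&-fst · #0)) · (&-intro · (&-snd · (&-fst · #0)) · (&-snd · #0)))) ,
  closed (ƛ (&-intro · (&-intro · (&-fst · #0) · (&-fst · (&-snd · #0))) · (&-snd · (&-snd · #0))))

&-curry : ∀ {A B C} → ((A & B) ⇒ C) ≈ (A ⇒ B ⇒ C)
&-curry =
  closed (ƛ (ƛ (ƛ (#2 · (&-intro · #1 · #0))))) ,
  closed (ƛ (ƛ (#1 · (&-fst · #0) · (&-snd · #0))))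

⇒-distribˡ-& : ∀ {A B C} → (A ⇒ (B & C)) ≈ ((A ⇒ B) & (A ⇒ C))
⇒-distribˡ-& =
  closed (ƛ (&-intro · ƛ (&-fst · (#1 · #0)) · ƛ (&-snd · (#1 · #0)))) ,
  closed (ƛ (ƛ (&-intro · (&-fst · #1 · #0) · (&-snd · #1 · #0))))

∨-distribʳ-& : ∀ {A B C} → ((A & B) ∨ᶠ C) ≈ ((A ∨ᶠ C) & (B ∨ᶠ C))
∨-distribʳ-& =
  closed (∨-elim · ƛ (&-intro · (∨-inl · (&-fst · #0)) · (∨-inl · (&-snd · #0)))
                 · ƛ (&-intro · (∨-inr · #0) · (∨-inr · #0))) ,
  closed (ƛ (∨-elim · ƛ (∨-elim · ƛ (∨-inl · (&-intro · #1 · #0)) · ƛ (∨-inr · #0) · (&-snd · #1))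
                    · ƛ (∨-inr · #0)
                    · (&-fst · #0)))

∨-distribˡ-& : ∀ {A B C} → (A ∨ᶠ (B & C)) ≈ ((A ∨ᶠ B) & (A ∨ᶠ C))
∨-distribˡ-& =
  closed (∨-elim · ƛ (&-intro · (∨-inl · #0) · (∨-inl · #0))
                 · ƛ (&-intro · (∨-inr · (&-fst · #0)) · (∨-inr · (&-snd · #0)))) ,
  closed (ƛ (∨-elim · ƛ (∨-inl · #0)
                    · ƛ (∨-elim · ƛ (∨-inl · #0) · ƛ (∨-inr · (&-intro · #1 · #0)) · (&-snd · #1))
                    · (&-fst · #0)))

_∨⇒_ : Formula → Formula → Formula
A ∨⇒ B = (A ⇒ B) ⇒ B

∨≈∨⇒ : ∀ {A B} → (A ∨ᶠ B) ≈ (A ∨⇒ B)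
∨≈∨⇒ =
  closed (∨-elim · ƛ (ƛ (#0 · #1)) · ƛ (ƛ #1)) ,
  closed (ƛ (peirce · ƛ (∨-inr · (#1 · ƛ (#1 · (∨-inl · #0))))))

flatten : ∀ {A : Set} → List⁺ (List⁺ A) → List⁺ A
flatten = foldr₁ _⁺++⁺_

module _ {A : Set} {P : A → Set} where

  All-⁺++⁺ : ∀ Xs Ys → All P (toList Xs) → All P (toList Ys) → All P (toList (Xs ⁺++⁺ Ys))
  All-⁺++⁺ (x ∷ xs) (y ∷ ys) = ++⁺

  All-flatten : ∀ Xss → All (All P ∘ toList) (toList Xss) → All P (toList (flatten Xss))
  All-flatten (Xs ∷ Xss) = go Xs Xss
    where
    go : ∀ Xs Xss → All (All P ∘ toList) (Xs ∷ Xss) → All P (toList (flatten (Xs ∷ Xss)))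
    go Xs []         (pXs ∷ [])   = pXs
    go Xs (Ys ∷ Yss) (pXs ∷ pYss) = All-⁺++⁺ Xs (flatten (Ys ∷ Yss)) pXs (go Ys Yss pYss)

  All-map : ∀ {B : Set} {Q : B → Set} {f : B → A} → (∀ {x} → Q x → P (f x)) →
            ∀ Xs → All Q (toList Xs) → All P (toList (List⁺.map f Xs))
  All-map Q⇒P (x ∷ xs) = map⁺ ∘ All.map Q⇒P

_⇛_ : List⁺ Formula → Formula → Formula
Xs ⇛ C = List.foldr _⇒_ C (toList Xs)

_⋎_ : List⁺ Formula → List⁺ Formula → List⁺ Formula
Xs ⋎ Ys = flatten (List⁺.map (λ x → List⁺.map (x ∨⇒_) Ys) Xs)

bigAnd-⁺++⁺ : ∀ Xs Ys → (bigAnd Xs & bigAnd Ys) ≈ bigAnd (Xs ⁺++⁺ Ys)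
bigAnd-⁺++⁺ (x ∷ xs) (y ∷ ys) = go x xs
  where
  go : ∀ x xs → (bigAnd (x ∷ xs) & bigAnd (y ∷ ys)) ≈ bigAnd ((x ∷ xs) ⁺++⁺ (y ∷ ys))
  go x []        = ≈-refl
  go x (x′ ∷ xs) = ≈-trans &-assoc (&-cong ≈-refl (go x′ xs))

bigAnd-flatten : ∀ Xss → bigAnd (List⁺.map bigAnd Xss) ≈ bigAnd (flatten Xss)
bigAnd-flatten (Xs ∷ Xss) = go Xs Xss
  where
  go : ∀ Xs Xss → bigAnd (List⁺.map bigAnd (Xs ∷ Xss)) ≈ bigAnd (flatten (Xs ∷ Xss))
  go Xs []         = ≈-refl
  go Xs (Ys ∷ Yss) = ≈-trans (&-cong ≈-refl (go Ys Yss)) (bigAnd-⁺++⁺ Xs (flatten (Ys ∷ Yss)))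

bigAnd-map-cong : ∀ {F G : Formula → Formula} → (∀ C → F C ≈ G C) →
                  ∀ Xs → bigAnd (List⁺.map F Xs) ≈ bigAnd (List⁺.map G Xs)
bigAnd-map-cong {F} {G} F≈G (x ∷ xs) = go x xs
  where
  go : ∀ x xs → bigAnd (List⁺.map F (x ∷ xs)) ≈ bigAnd (List⁺.map G (x ∷ xs))
  go x []        = F≈G x
  go x (x′ ∷ xs) = &-cong (F≈G x) (go x′ xs)

bigAnd-distrib : ∀ {F : Formula → Formula} → (∀ B C → F (B & C) ≈ (F B & F C)) →
                 ∀ Xs → F (bigAnd Xs) ≈ bigAnd (List⁺.map F Xs)
bigAnd-distrib {F} F-distrib (x ∷ xs) = go x xs
  where
  go : ∀ x xs → F (bigAnd (x ∷ xs)) ≈ bigAnd (List⁺.map F (x ∷ xs))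
  go x []        = ≈-refl
  go x (x′ ∷ xs) = ≈-trans (F-distrib x (bigAnd (x′ ∷ xs))) (&-cong ≈-refl (go x′ xs))

bigAnd-⇒ : ∀ Xs C → (bigAnd Xs ⇒ C) ≈ (Xs ⇛ C)
bigAnd-⇒ (x ∷ xs) C = go x xs
  where
  go : ∀ x xs → (bigAnd (x ∷ xs) ⇒ C) ≈ ((x ∷ xs) ⇛ C)
  go x []        = ≈-refl
  go x (x′ ∷ xs) = ≈-trans &-curry (⇒-cong ≈-refl (go x′ xs))

∨-bigAnd : ∀ A Ys → (A ∨ᶠ bigAnd Ys) ≈ bigAnd (List⁺.map (A ∨⇒_) Ys)
∨-bigAnd A Ys = ≈-trans (bigAnd-distrib (λ _ _ → ∨-distribˡ-&) Ys) (bigAnd-map-cong (λ _ → ∨≈∨⇒) Ys)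

bigAnd-⇛ : ∀ Xs Ys → (bigAnd Xs ⇒ bigAnd Ys) ≈ bigAnd (List⁺.map (Xs ⇛_) Ys)
bigAnd-⇛ Xs Ys =
  ≈-trans (bigAnd-distrib (λ _ _ → ⇒-distribˡ-&) Ys) (bigAnd-map-cong (bigAnd-⇒ Xs) Ys)

bigAnd-⋎ : ∀ Xs Ys → (bigAnd Xs ∨ᶠ bigAnd Ys) ≈ bigAnd (Xs ⋎ Ys)
bigAnd-⋎ Xs Ys = begin
  bigAnd Xs ∨ᶠ bigAnd Ys                         ≈⟨ bigAnd-distrib (λ _ _ → ∨-distribʳ-&) Xs ⟩
  bigAnd (List⁺.map (_∨ᶠ bigAnd Ys) Xs)          ≈⟨ bigAnd-map-cong (λ x → ∨-bigAnd x Ys) Xs ⟩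
  bigAnd (List⁺.map (bigAnd ∘ ∨⇒Ys) Xs)          ≡⟨ cong bigAnd (map-∘ Xs) ⟩
  bigAnd (List⁺.map bigAnd (List⁺.map ∨⇒Ys Xs))  ≈⟨ bigAnd-flatten (List⁺.map ∨⇒Ys Xs) ⟩
  bigAnd (Xs ⋎ Ys)                               ∎
  where
  open Relation.Binary.Reasoning.Setoid ≈-setoid
  ∨⇒Ys : Formula → List⁺ Formula
  ∨⇒Ys x = List⁺.map (x ∨⇒_) Ys

All-⋎ : ∀ Xs Ys → All Implicative (toList Xs) → All Implicative (toList Ys) →
        All Implicative (toList (Xs ⋎ Ys))
All-⋎ Xs Ys iXs iYs =
  All-flatten (List⁺.map (λ x → List⁺.map (x ∨⇒_) Ys) Xs)
    (All-map (λ ix → All-map (λ iy → (ix ⇒ iy) ⇒ iy) Ys iYs) Xs iXs)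

foldr-⇒-implicative : ∀ {xs C} → All Implicative xs → Implicative C → Implicative (List.foldr _⇒_ C xs)
foldr-⇒-implicative []         iC = iC
foldr-⇒-implicative (ix ∷ ixs) iC = ix ⇒ foldr-⇒-implicative ixs iC

conjuncts : Formula → List⁺ Formula
conjuncts (var i)  = [ var i ]
conjuncts (A ⇒ B)  = List⁺.map (conjuncts A ⇛_) (conjuncts B)
conjuncts (A ∨ᶠ B) = conjuncts A ⋎ conjuncts B
conjuncts (A & B)  = conjuncts A ⁺++⁺ conjuncts B

conjuncts-implicative : ∀ A → All Implicative (toList (conjuncts A))
conjuncts-implicative (var i)  = var i ∷ []
conjuncts-implicative (A ⇒ B)  =
  All-map (foldr-⇒-implicative (conjuncts-implicative A)) (conjuncts B) (conjuncts-implicative B)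
conjuncts-implicative (A ∨ᶠ B) =
  All-⋎ (conjuncts A) (conjuncts B) (conjuncts-implicative A) (conjuncts-implicative B)
conjuncts-implicative (A & B)  =
  All-⁺++⁺ (conjuncts A) (conjuncts B) (conjuncts-implicative A) (conjuncts-implicative B)

conjuncts-equiv : ∀ A → A ≈ bigAnd (conjuncts A)
conjuncts-equiv (var i)  = ≈-refl
conjuncts-equiv (A ⇒ B)  =
  ≈-trans (⇒-cong (conjuncts-equiv A) (conjuncts-equiv B)) (bigAnd-⇛ (conjuncts A) (conjuncts B))
conjuncts-equiv (A ∨ᶠ B) =
  ≈-trans (∨-cong (conjuncts-equiv A) (conjuncts-equiv B)) (bigAnd-⋎ (conjuncts A) (conjuncts B))
conjuncts-equiv (A & B)  =
  ≈-trans (&-cong (conjuncts-equiv A) (conjuncts-equiv B)) (bigAnd-⁺++⁺ (conjuncts A) (conjuncts B))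

K-valid : ∀ a b → not a ∨ (not b ∨ a) ≡ true
K-valid false b     = refl
K-valid true  false = refl
K-valid true  true  = refl

S-valid : ∀ a b c → not (not a ∨ (not b ∨ c)) ∨ (not (not a ∨ b) ∨ (not a ∨ c)) ≡ true
S-valid false b     c     = refl
S-valid true  false c     = refl
S-valid true  true  false = refl
S-valid true  true  true  = refl

P-valid : ∀ a b → not (not (not a ∨ b) ∨ a) ∨ a ≡ true
P-valid false b     = refl
P-valid true  false = refl
P-valid true  true  = refl

∨I₁-valid : ∀ a b → not a ∨ (a ∨ b) ≡ true
∨I₁-valid false b = refl
∨I₁-valid true  b = refl

∨I₂-valid : ∀ a b → not a ∨ (b ∨ a) ≡ true
∨I₂-valid false b     = refl
∨I₂-valid true  false = refl
∨I₂-valid true  true  = refl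

∨E-valid : ∀ a b c → not (not a ∨ c) ∨ (not (not b ∨ c) ∨ (not (a ∨ b) ∨ c)) ≡ true
∨E-valid false false c     = refl
∨E-valid false true  false = refl
∨E-valid false true  true  = refl
∨E-valid true  b     false = refl
∨E-valid true  false true  = refl
∨E-valid true  true  true  = refl

&E₁-valid : ∀ a b → not (a ∧ b) ∨ a ≡ true
&E₁-valid false b     = refl
&E₁-valid true  false = refl
&E₁-valid true  true  = refl

&E₂-valid : ∀ a b → not (a ∧ b) ∨ b ≡ true
&E₂-valid false b     = refl
&E₂-valid true  false = refl
&E₂-valid true  true  = refl

&I-valid : ∀ a b → not a ∨ (not b ∨ (a ∧ b)) ≡ true
&I-valid false b     = refl
&I-valid true  false = refl
&I-valid true  true  = refl

mp-valid : ∀ a b → not a ∨ b ≡ true → a ≡ true → b ≡ true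
mp-valid true b a⇒b refl = a⇒b

soundness : ∀ {A} → ⊢ A → ⊨ A
soundness (ax-K A B)     v = K-valid (⟦ A ⟧ v) (⟦ B ⟧ v)
soundness (ax-S A B C)   v = S-valid (⟦ A ⟧ v) (⟦ B ⟧ v) (⟦ C ⟧ v)
soundness (ax-P A B)     v = P-valid (⟦ A ⟧ v) (⟦ B ⟧ v)
soundness (ax-∨I₁ A B)   v = ∨I₁-valid (⟦ A ⟧ v) (⟦ B ⟧ v)
soundness (ax-∨I₂ A B)   v = ∨I₂-valid (⟦ A ⟧ v) (⟦ B ⟧ v)
soundness (ax-∨E A B C)  v = ∨E-valid (⟦ A ⟧ v) (⟦ B ⟧ v) (⟦ C ⟧ v)
soundness (ax-&E₁ A B)   v = &E₁-valid (⟦ A ⟧ v) (⟦ B ⟧ v)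
soundness (ax-&E₂ A B)   v = &E₂-valid (⟦ A ⟧ v) (⟦ B ⟧ v)
soundness (ax-&I A B)    v = &I-valid (⟦ A ⟧ v) (⟦ B ⟧ v)
soundness (mp {A} {B} f x) v = mp-valid (⟦ A ⟧ v) (⟦ B ⟧ v) (soundness f v) (soundness x v)

mainTheorem5 : (A : Formula) → Σ (List⁺ Formula) (λ Bs → All Implicative (toList Bs) × (⊢ (A ⇔ bigAnd Bs)) × (⊨ (A ⇔ bigAnd Bs)))
mainTheorem5 A =
  conjuncts A , conjuncts-implicative A , ⊢A⇔Bs , soundness ⊢A⇔Bs
  where
  ⊢A⇔Bs : ⊢ (A ⇔ bigAnd (conjuncts A))
  ⊢A⇔Bs = ≈⇒⊢⇔ (conjuncts-equiv A)
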